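{- Let $b\ge 2$ be an integer and let $f=S_{1,b}$. Then for every positive integer $n$ some iterate $f^k(n)$ ($k\ge 0$) lies in one of the following cycles of $f$: if $b=2$, the fixed point $10_2=2$; if $b\ge 3$, either the cycle $(2,3,\dots,b-1,10_b)$ (where $10_b=b$, and $f(j)=j+1$ for $2\le j\le b-1$, $f(b)=2$) or the fixed point $1(b-2)_b=2b-2$.
   Context: For integers $t\ge 0$, $b\ge 2$, the $t$-shifted Sloane map in base $b$ is $S_{t,b}(n)=\prod_{i=0}^k (d_i+t)$, where $n=\sum_{i=0}^k d_ib^i$ is the base-$b$ expansion of $n$ ($0\le d_i\le b-1$, $d_k>0$). $f^0(n)=n$ and $f^k(n)=f(f^{k-1}(n))$. The notation $(x_1x_2\dots)_b$ denotes a numeral in base $b$. -}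

module Defs where

open import Data.Nat using (ℕ; zero; suc; _+_; _*_; _∸_; _≤_; _<_; NonZero)
open import Data.Nat.DivMod using (_/_; _%_)
open import Data.List using (List; []; _∷_; map)
open import Data.Nat.ListAction using (product)

-- base-b digits of n, least significant first, using fuel (fuel ≥ n suffices,
-- since each step divides by b ≥ 2). digits of 0 is the empty list.
digitsAux : (b : ℕ) → .{{_ : NonZero b}} → ℕ → ℕ → List ℕ
digitsAux b zero    n = []
digitsAux b (suc f) zero = []
digitsAux b (suc f) (suc n) = (suc n % b) ∷ digitsAux b f (suc n / b)

digits : (b : ℕ) → .{{_ : NonZero b}} → ℕ → List ℕ
digits b n = digitsAux b n n

sloane : (t b : ℕ) → .{{_ : NonZero b}} → ℕ → ℕ
sloane t b n = product (map (λ d → d + t) (digits b n))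

iterate : (ℕ → ℕ) → ℕ → ℕ → ℕ
iterate f zero    n = n
iterate f (suc k) n = f (iterate f k n)

-- Write n = r + q b with last digit r < b. Then f n = (r + 1) f q and f q ≤ q + 1, which
-- forces f n < n for n > b except in two situations: n = 2b − 2 = (1(b−2))_b, a fixed
-- point, and r = b − 1 with f q = q + 1, where f n = (q + 1) b and hence f (f n) = f (q + 1)
-- with q + 1 < n. Since the union of the claimed cycles is f-invariant, strong induction
-- on n shows that every n reaches it.
module Submission where

open import Defs
open import Data.Nat using (ℕ; zero; suc; _+_; _*_; _∸_; _≤_; _<_; NonZero; z≤n; s≤s; z<s; s≤s⁻¹; _≤?_)
open import Data.Nat.Properties
open import Data.Nat.DivMod
open import Data.Nat.Induction using (<-rec)
open import Data.Nat.Tactic.RingSolver using (solve-∀)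
open import Data.List using (_∷_; map)
open import Data.Nat.ListAction using (product)
open import Data.Product using (∃-syntax; _×_; _,_)
open import Data.Sum using (_⊎_; inj₁; inj₂)
open import Relation.Nullary using (yes; no)
open import Relation.Binary.PropositionalEquality

iterate-shift : ∀ (g : ℕ → ℕ) k n → iterate g k (g n) ≡ iterate g (suc k) n
iterate-shift g zero    n = refl
iterate-shift g (suc k) n = cong g (iterate-shift g k n)

[m+kn]%n≡m : ∀ {m} k {n} .{{_ : NonZero n}} → m < n → (m + k * n) % n ≡ m
[m+kn]%n≡m {m} k {n} m<n = trans ([m+kn]%n≡m%n m k n) (m<n⇒m%n≡m m<n)

[m+kn]/n≡k : ∀ {m} k {n} .{{_ : NonZero n}} → m < n → (m + k * n) / n ≡ k
[m+kn]/n≡k {m} k {n} m<n = begin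
  (m + k * n) / n      ≡⟨ +-distrib-/ m (k * n) no-carry ⟩
  m / n + k * n / n    ≡⟨ cong₂ _+_ (m<n⇒m/n≡0 m<n) (m*n/n≡m k n) ⟩
  k                    ∎
  where
  open ≡-Reasoning
  no-carry : m % n + k * n % n < n
  no-carry = subst₂ (λ x y → x + y < n) (sym (m<n⇒m%n≡m m<n)) (sym (m*n%n≡0 k n))
                    (subst (_< n) (sym (+-identityʳ m)) m<n)

[m+1]*[1+n]≡1+m+n*[1+m] : ∀ m n → (m + 1) * suc n ≡ suc (m + n * suc m)
[m+1]*[1+n]≡1+m+n*[1+m] = solve-∀

digit-weight-≤ : ∀ {r b} q → r < b → (r + 1) * suc q ≤ suc (r + q * b)
digit-weight-≤ {r} {b} q r<b = begin
  (r + 1) * suc q      ≡⟨ [m+1]*[1+n]≡1+m+n*[1+m] r q ⟩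
  suc (r + q * suc r)  ≤⟨ s≤s (+-monoʳ-≤ r (*-monoʳ-≤ q r<b)) ⟩
  suc (r + q * b)      ∎
  where open ≤-Reasoning

digit-weight-< : ∀ {r b q} → 1 < b → r < b → 1 ≤ q → (r + 1) * q < r + q * b
digit-weight-< {zero}  {b} {suc q} 1<b _   _ =
  subst (_< suc q * b) (sym (*-identityˡ (suc q))) (m<m*n (suc q) b 1<b)
digit-weight-< {suc r} {b} {q}     _   r<b _ = begin-strict
  (suc r + 1) * q  ≤⟨ *-monoˡ-≤ q (subst (_≤ b) (+-comm 1 (suc r)) r<b) ⟩
  b * q            ≡⟨ *-comm b q ⟩
  q * b            <⟨ m<n+m (q * b) z<s ⟩
  suc r + q * b    ∎
  where open ≤-Reasoning

top-digit-weight-< : ∀ r s q → 1 < q * s → (r + 1) * suc q < r + q * (s + suc r)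
top-digit-weight-< r s q 1<qs = begin-strict
  (r + 1) * suc q          ≡⟨ [m+1]*[1+n]≡1+m+n*[1+m] r q ⟩
  1 + (r + q * suc r)      <⟨ +-monoˡ-< (r + q * suc r) 1<qs ⟩
  q * s + (r + q * suc r)  ≡⟨ regroup r s q ⟩
  r + q * (s + suc r)      ∎
  where
  open ≤-Reasoning
  regroup : ∀ r s q → q * s + (r + q * suc r) ≡ r + q * (s + suc r)
  regroup = solve-∀

digits-suc : ∀ b .{{_ : NonZero b}} → 1 < b → ∀ n →
             digits b (suc n) ≡ suc n % b ∷ digits b (suc n / b)
digits-suc b 1<b n = cong (suc n % b ∷_) (fuel-irrelevant n (suc n / b) (suc n / b) (quotient≤ n) ≤-refl)
  where
  quotient≤ : ∀ m → suc m / b ≤ m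
  quotient≤ m = s≤s⁻¹ (m/n<m (suc m) b 1<b)

  fuel-irrelevant : ∀ f g m → m ≤ f → m ≤ g → digitsAux b f m ≡ digitsAux b g m
  fuel-irrelevant zero    zero    zero    _         _         = refl
  fuel-irrelevant zero    (suc g) zero    _         _         = refl
  fuel-irrelevant (suc f) zero    zero    _         _         = refl
  fuel-irrelevant (suc f) (suc g) zero    _         _         = refl
  fuel-irrelevant (suc f) (suc g) (suc m) (s≤s m≤f) (s≤s m≤g) =
    cong (suc m % b ∷_) (fuel-irrelevant f g (suc m / b) (≤-trans (quotient≤ m) m≤f) (≤-trans (quotient≤ m) m≤g))

sloane-suc : ∀ t b .{{_ : NonZero b}} → 1 < b → ∀ n →
             sloane t b (suc n) ≡ (suc n % b + t) * sloane t b (suc n / b)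
sloane-suc t b 1<b n = cong (λ ds → product (map (λ d → d + t) ds)) (digits-suc b 1<b n)

-- The base is b = 2 + c, so that 2b − 2 = c + 1 · b and the values of f at 0 and 1 compute.
module _ (c : ℕ) where

  private
    b : ℕ
    b = 2 + c

    1<b : 1 < b
    1<b = s≤s (s≤s z≤n)

  f : ℕ → ℕ
  f = sloane 1 b

  f-% : ∀ n → f n ≡ (n % b + 1) * f (n / b)
  f-% zero    = refl
  f-% (suc n) = sloane-suc 1 b 1<b n

  f-digit : ∀ {r} q → r < b → f (r + q * b) ≡ (r + 1) * f q
  f-digit {r} q r<b =
    trans (f-% (r + q * b)) (cong₂ (λ d m → (d + 1) * f m) ([m+kn]%n≡m q r<b) ([m+kn]/n≡k q r<b))

  f-≤-suc : ∀ n → f n ≤ suc n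
  f-≤-suc = <-rec (λ n → f n ≤ suc n) bound
    where
    bound : ∀ n → (∀ {m} → m < n → f m ≤ suc m) → f n ≤ suc n
    bound zero    _  = ≤-refl
    bound (suc n) ih = begin
      f (suc n)          ≡⟨ f-% (suc n) ⟩
      (r + 1) * f q      ≤⟨ *-monoʳ-≤ (r + 1) (ih (m/n<m (suc n) b 1<b)) ⟩
      (r + 1) * suc q    ≤⟨ digit-weight-≤ q (m%n<n (suc n) b) ⟩
      suc (r + q * b)    ≡⟨ cong suc (m≡m%n+[m/n]*n (suc n) b) ⟨
      suc (suc n)        ∎
      where
      open ≤-Reasoning
      r = suc n % b
      q = suc n / b

  f-single-digit : ∀ {x} → x < b → f x ≡ suc x
  f-single-digit {x} x<b = begin
    f x                ≡⟨ cong f (+-identityʳ x) ⟨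
    f (x + 0 * b)      ≡⟨ f-digit 0 x<b ⟩
    (x + 1) * 1        ≡⟨ *-identityʳ (x + 1) ⟩
    x + 1              ≡⟨ +-comm x 1 ⟩
    suc x              ∎
    where open ≡-Reasoning

  f-base : f b ≡ 2
  f-base = trans (cong f (sym (+-identityʳ b))) (f-digit 1 z<s)

  f-fixed : f (2 * b ∸ 2) ≡ 2 * b ∸ 2
  f-fixed = trans (f-digit 1 (m<n⇒m<1+n (n<1+n c))) (double c)
    where
    double : ∀ c → (c + 1) * 2 ≡ c + 1 * (2 + c)
    double = solve-∀

  data Descent (n : ℕ) : Set where
    fixed     : n ≡ 2 * b ∸ 2 → Descent n
    decreases : f n < n → Descent n
    skips     : ∀ m → m < n → f (f n) ≡ f m → Descent n

  top-decreases : ∀ r s q → s + suc r ≡ b → 1 < q * s → f (r + q * b) ≡ (r + 1) * suc q →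
                  f (r + q * b) < r + q * b
  top-decreases r s q e 1<qs fn≡ = begin-strict
    f (r + q * b)        ≡⟨ fn≡ ⟩
    (r + 1) * suc q      <⟨ top-digit-weight-< r s q 1<qs ⟩
    r + q * (s + suc r)  ≡⟨ cong (λ d → r + q * d) e ⟩
    r + q * b            ∎
    where open ≤-Reasoning

  descent-top : ∀ r s q → s + suc r ≡ b → 1 ≤ q → f (r + q * b) ≡ (r + 1) * suc q → Descent (r + q * b)
  descent-top _       _             zero          _    () _
  descent-top zero    zero          _             ()   _ _
  descent-top (suc r) zero          (suc q)       refl _ fn≡ = skips (suc (suc q)) m<n ffn≡
    where
    m<n : suc (suc q) < suc r + suc q * b
    m<n = +-mono-≤ (s≤s z≤n) (m<m*n (suc q) b 1<b)

    ffn≡ : f (f (suc r + suc q * b)) ≡ f (suc (suc q))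
    ffn≡ = begin
      f (f (suc r + suc q * b))       ≡⟨ cong f fn≡ ⟩
      f ((suc r + 1) * suc (suc q))   ≡⟨ cong f (*-comm (suc r + 1) (suc (suc q))) ⟩
      f (suc (suc q) * (suc r + 1))   ≡⟨ cong (λ d → f (suc (suc q) * d)) (+-comm (suc r) 1) ⟩
      f (0 + suc (suc q) * b)         ≡⟨ f-digit (suc (suc q)) z<s ⟩
      1 * f (suc (suc q))             ≡⟨ *-identityˡ _ ⟩
      f (suc (suc q))                 ∎
      where open ≡-Reasoning
  descent-top r (suc zero)    (suc zero)    refl _ _   = fixed refl
  descent-top r (suc zero)    (suc (suc q)) e    _ fn≡ = decreases (top-decreases r 1 (suc (suc q)) e (s≤s (s≤s z≤n)) fn≡)
  descent-top r (suc (suc s)) (suc q)       e    _ fn≡ = decreases (top-decreases r (suc (suc s)) (suc q) e (s≤s (s≤s z≤n)) fn≡)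

  descent-digits : ∀ {r} q → r < b → 1 ≤ q → Descent (r + q * b)
  descent-digits {r} q r<b 1≤q with m≤n⇒m<n∨m≡n (f-≤-suc q)
  ... | inj₁ fq<1+q = decreases (begin-strict
    f (r + q * b)   ≡⟨ f-digit q r<b ⟩
    (r + 1) * f q   ≤⟨ *-monoʳ-≤ (r + 1) (s≤s⁻¹ fq<1+q) ⟩
    (r + 1) * q     <⟨ digit-weight-< 1<b r<b 1≤q ⟩
    r + q * b       ∎)
    where open ≤-Reasoning
  ... | inj₂ fq≡1+q =
    descent-top r (b ∸ suc r) q (m∸n+n≡m r<b) 1≤q (trans (f-digit q r<b) (cong ((r + 1) *_) fq≡1+q))

  descent : ∀ {n} → b < n → Descent n
  descent {n} b<n = subst Descent (sym (m≡m%n+[m/n]*n n b))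
    (descent-digits (n / b) (m%n<n n b) (m≥n⇒m/n>0 (<⇒≤ b<n)))

  InCycle : ℕ → Set
  InCycle x = (b ≡ 2 → x ≡ 2) × (3 ≤ b → (2 ≤ x × x ≤ b) ⊎ x ≡ 2 * b ∸ 2)

  inCycle-≤b : ∀ {x} → 2 ≤ x → x ≤ b → InCycle x
  inCycle-≤b {x} 2≤x x≤b = (λ b≡2 → ≤-antisym (subst (x ≤_) b≡2 x≤b) 2≤x) , λ _ → inj₁ (2≤x , x≤b)

  inCycle-fixed : InCycle (2 * b ∸ 2)
  inCycle-fixed = (λ b≡2 → cong (λ d → 2 * d ∸ 2) b≡2) , λ _ → inj₂ refl

  f-≤b : ∀ {x} → 2 ≤ x → x ≤ b → 2 ≤ f x × f x ≤ b
  f-≤b {x} 2≤x x≤b with m≤n⇒m<n∨m≡n x≤b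
  ... | inj₁ x<b rewrite f-single-digit x<b = m≤n⇒m≤1+n 2≤x , x<b
  ... | inj₂ refl rewrite f-base            = ≤-refl , 1<b

  inCycle-f : ∀ {x} → InCycle x → InCycle (f x)
  inCycle-f {x} (base2 , base≥3) =
    (λ b≡2 → trans (cong f (trans (base2 b≡2) (sym b≡2))) f-base) , λ 3≤b → cycle (base≥3 3≤b)
    where
    cycle : (2 ≤ x × x ≤ b) ⊎ x ≡ 2 * b ∸ 2 → (2 ≤ f x × f x ≤ b) ⊎ f x ≡ 2 * b ∸ 2
    cycle (inj₁ (2≤x , x≤b)) = inj₁ (f-≤b 2≤x x≤b)
    cycle (inj₂ refl)        = inj₂ f-fixed

  Reaches : ℕ → Set
  Reaches n = ∃[ k ] InCycle (iterate f k n)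

  reaches-f⁻¹ : ∀ {n} → Reaches (f n) → Reaches n
  reaches-f⁻¹ {n} (k , inCycle) = suc k , subst InCycle (iterate-shift f k n) inCycle

  reaches-f : ∀ {n} → Reaches n → Reaches (f n)
  reaches-f {n} (k , inCycle) = k , subst InCycle (sym (iterate-shift f k n)) (inCycle-f inCycle)

  reaches-≤b : ∀ n → n ≤ b → Reaches n
  -- The empty product gives f 0 = 1, so 0 ↦ 1 ↦ 2 and theorem7 needs no positivity.
  reaches-≤b zero             _   = reaches-f⁻¹ {0} (reaches-f⁻¹ {1} (0 , inCycle-≤b ≤-refl 1<b))
  reaches-≤b (suc zero)       _   = reaches-f⁻¹ {1} (0 , inCycle-≤b ≤-refl 1<b)
  reaches-≤b (suc (suc n))    n≤b = 0 , inCycle-≤b (s≤s (s≤s z≤n)) n≤b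

  reaches : ∀ n → Reaches n
  reaches = <-rec Reaches step
    where
    step : ∀ n → (∀ {m} → m < n → Reaches m) → Reaches n
    step n rec with n ≤? b
    ... | yes n≤b = reaches-≤b n n≤b
    ... | no  n≰b with descent (≰⇒> n≰b)
    ...   | fixed n≡         = 0 , subst InCycle (sym n≡) inCycle-fixed
    ...   | decreases fn<n   = reaches-f⁻¹ (rec fn<n)
    ...   | skips m m<n ffn≡ = reaches-f⁻¹ (reaches-f⁻¹ (subst Reaches (sym ffn≡) (reaches-f (rec m<n))))

theorem7 : (b : ℕ) → .{{_ : NonZero b}} → 2 ≤ b → (n : ℕ) → 0 < n →
    ∃[ k ] ((b ≡ 2 → iterate (sloane 1 b) k n ≡ 2)
          × (3 ≤ b → (2 ≤ iterate (sloane 1 b) k n × iterate (sloane 1 b) k n ≤ b)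
                     ⊎ iterate (sloane 1 b) k n ≡ 2 * b ∸ 2))
theorem7 (suc (suc c)) _       n _ = reaches c n
theorem7 (suc zero)    (s≤s ()) _ _
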